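{- Let $T$ be a semicomplete digraph and let $(T,K,c)$ be an instance of $(k,c)$-DDP with requests $(s_1,t_1),\dots,(s_k,t_k)$ and $2c>k$. Let $(A,B,C)$ be an $m$-triple of $T$ with matching map $\mathrm{Mat}:C\to A$, such that no endpoint of any request lies in $A\cup B\cup C$, and $T$ has no arc from a vertex of $C$ to a vertex of $B$ and no arc from a vertex of $B$ to a vertex of $A$. Let $\mathcal{P}=\{P_1,\dots,P_k\}$ be a solution of the instance ($P_i$ from $s_i$ to $t_i$) minimizing $\sum_{i\in[k]}|V(P_i)|$. If there is $b\in B$ with $|\mathrm{List}(b)|\le c-1$, then for every $i\in[k]$: (1) $|V(P_i)\cap A|\le 8c+4$, and (2) $|V(P_i)\cap C|\le 8c+4$.
   Context: $(k,c)$-DDP: given a digraph, $k$ requests $(s_i,t_i)$ and an integer $c$, find directed paths $P_i$ from $s_i$ to $t_i$ such that each vertex lies in at most $c$ of them. A semicomplete digraph has at least one arc between every two distinct vertices. An $m$-triple $(A,B,C)$ consists of pairwise disjoint vertex sets of size $m$ with orderings $(a_1..a_m),(b_1..b_m),(c_1..c_m)$ such that $(a_i,b_j),(b_i,c_j)$ are arcs for all $i,j$ and $(c_i,a_i)$ is an arc for all $i$; $\mathrm{Mat}(c_i)=a_i$. For a vertex $v$, $\mathrm{List}(v)=\{i\in[k]: v\in V(P_i)\}$. -}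

module Defs where

open import Data.Nat using (ℕ; _+_; _≤_)
open import Data.Fin using (Fin; _≟_)
open import Data.Fin.Properties using (any?)
open import Data.List using (List; length; filter; head; last; allFin; map)
open import Data.Nat.ListAction using (sum)
open import Data.List.Relation.Unary.Unique.Propositional using (Unique)
open import Data.List.Relation.Unary.Linked using (Linked)
open import Data.List.Membership.Propositional using (_∈_)
import Data.List.Membership.DecPropositional as DecMem
open import Data.Maybe using (just)
open import Data.Product using (_×_; ∃)
open import Data.Sum using (_⊎_)
open import Relation.Binary.PropositionalEquality using (_≡_; _≢_)

Semicomplete : ∀ {n} → (Fin n → Fin n → Set) → Set
Semicomplete {n} E = ∀ (u v : Fin n) → u ≢ v → E u v ⊎ E v u

IsPath : ∀ {n} → (Fin n → Fin n → Set) → Fin n → Fin n → List (Fin n) → Set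
IsPath E s t P = Unique P × Linked E P × head P ≡ just s × last P ≡ just t

ListOf : ∀ {n k} → (Fin k → List (Fin n)) → Fin n → List (Fin k)
ListOf {n} {k} P v = filter (λ i → v ∈? P i) (allFin k)
  where open DecMem (_≟_ {n}) using (_∈?_)

IsSolution : ∀ {n k} → (Fin n → Fin n → Set) → (Fin k → Fin n) → (Fin k → Fin n) → ℕ
           → (Fin k → List (Fin n)) → Set
IsSolution E s t c P = (∀ i → IsPath E (s i) (t i) (P i)) × (∀ v → length (ListOf P v) ≤ c)

totalSize : ∀ {n k} → (Fin k → List (Fin n)) → ℕ
totalSize {k = k} P = sum (map (λ i → length (P i)) (allFin k))

InImage : ∀ {n m} → (Fin m → Fin n) → Fin n → Set
InImage f v = ∃ λ j → f j ≡ v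

countIn : ∀ {n m} → (Fin m → Fin n) → List (Fin n) → ℕ
countIn f P = length (filter (λ v → any? (λ j → f j ≟ v)) P)

-- An m-triple (A,B,C) with orderings a, b, c (so Mat(c i) = a i)
record Triple {n : ℕ} (E : Fin n → Fin n → Set) (m : ℕ) : Set where
  field
    a b c : Fin m → Fin n
    a-inj : ∀ i j → a i ≡ a j → i ≡ j
    b-inj : ∀ i j → b i ≡ b j → i ≡ j
    c-inj : ∀ i j → c i ≡ c j → i ≡ j
    ab-disj : ∀ i j → a i ≢ b j
    bc-disj : ∀ i j → b i ≢ c j
    ac-disj : ∀ i j → a i ≢ c j
    ab-arc : ∀ i j → E (a i) (b j)
    bc-arc : ∀ i j → E (b i) (c j)
    ca-arc : ∀ i → E (c i) (a i)

  InABC : Fin n → Set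
  InABC v = InImage a v ⊎ InImage b v ⊎ InImage c v

-- Minimality forbids shortcuts: a path P_i of a minimal solution cannot be rerouted through
-- fewer new vertices of spare capacity.  The low-load vertex b ∈ B sends arcs to all of C, and
-- every a ∈ A sends an arc to b.  Hence, apart from a window of four consecutive vertices
-- (around b if b ∈ P_i, at the first A-vertex otherwise), every a_j on P_i has its mate c_j off
-- P_i and saturated, since otherwise b → c_j → a_j would be a shortcut.  Symmetrically, apart
-- from a window on each path, a vertex c_j has its mate a_j off the paths through c_j and
-- saturated.  A saturated c_j outside all these windows would thus have load(c_j) + load(a_j)
-- ≥ 2c > k on disjoint sets of paths, which is impossible; so the mates of the A-vertices of
-- P_i lie in the window of P_i or in one of k windows: at most 4 + 4k ≤ 8c + 4 of them.  The
-- bound for C is the bound for A in the reversed digraph, where the roles of A and C swap.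
module Submission where

open import Defs
open import Data.Nat using (ℕ; zero; suc; _+_; _*_; _∸_; _≤_; _<_; z≤n; s≤s; _≤?_; _<?_)
open import Data.Nat.Properties hiding (_≟_)
open import Data.Nat.ListAction using (sum)
open import Data.Fin using (Fin; _≟_)
open import Data.Fin.Properties using (any?)
open import Data.List
  using (List; []; _∷_; _++_; [_]; _∷ʳ_; length; filter; head; last; allFin; map; concatMap; take; drop; reverse)
open import Data.List.Properties
  using (++-assoc; length-++; length-map; length-take; length-tabulate; length-reverse; unfold-reverse;
         reverse-involutive; map-cong)
open import Data.List.Relation.Unary.All as All using (All)
open import Data.List.Relation.Unary.AllPairs using ([]; _∷_)
open import Data.List.Relation.Unary.Any as Any using (here; there)
open import Data.List.Relation.Unary.Any.Properties using (reverse⁺; reverse⁻)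
open import Data.List.Relation.Unary.Linked as Linked using (Linked; []; [-]; _∷_)
import Data.List.Relation.Unary.Linked.Properties as Linked
open import Data.List.Relation.Unary.Unique.Propositional using (Unique)
import Data.List.Relation.Unary.Unique.Propositional.Properties as Unique
open import Data.List.Relation.Binary.Permutation.Propositional using (↭-sym; ↭⇒↭ₛ)
open import Data.List.Relation.Binary.Permutation.Propositional.Properties using (↭-reverse; ↭-length; filter-↭)
import Data.List.Relation.Binary.Permutation.Setoid.Properties as Permutationₛ
open import Data.List.Membership.Propositional using (_∈_; _∉_)
open import Data.List.Membership.Propositional.Properties
  using (∈-++⁺ˡ; ∈-++⁺ʳ; ∈-++⁻; ∈-map⁺; ∈-filter⁺; ∈-filter⁻; ∈-allFin; ∈-concatMap⁺)
import Data.List.Membership.DecPropositional as DecMembership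
open import Data.Maybe using (Maybe; just; nothing)
open import Data.Maybe.Relation.Binary.Connected using (Connected; just)
open import Data.Vec.Functional using (updateAt)
open import Data.Vec.Functional.Properties using (updateAt-updates; updateAt-minimal)
open import Data.Product using (_×_; _,_; proj₁; proj₂; ∃; ∃₂)
open import Data.Sum as Sum using (_⊎_; inj₁; inj₂)
open import Data.Empty using (⊥; ⊥-elim)
open import Function using (id; const; flip; _∘_)
open import Relation.Nullary using (¬_; yes; no)
open import Relation.Unary using (Decidable)
open import Relation.Binary.PropositionalEquality hiding ([_])

∈⇒removal : ∀ {A : Set} {v : A} {ys} → v ∈ ys →
            ∃ λ ys′ → length ys ≡ suc (length ys′) × (∀ {w} → w ∈ ys → w ≢ v → w ∈ ys′)
∈⇒removal {ys = y ∷ ys} (here refl) = ys , refl , λ where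
  (here w≡v) w≢v → ⊥-elim (w≢v w≡v)
  (there w∈) _ → w∈
∈⇒removal {ys = y ∷ ys} (there v∈) with ys′ , |ys|≡ , keep ← ∈⇒removal v∈ =
  y ∷ ys′ , cong suc |ys|≡ , λ where
    (here w≡y) _ → here w≡y
    (there w∈) w≢v → there (keep w∈ w≢v)

length-≤-by-injection : ∀ {A B : Set} (f : A → B) {xs : List A} {ys : List B} → Unique xs →
                        (∀ {x y} → x ∈ xs → y ∈ xs → f x ≡ f y → x ≡ y) →
                        (∀ {x} → x ∈ xs → f x ∈ ys) → length xs ≤ length ys
length-≤-by-injection f {[]} _ _ _ = z≤n
length-≤-by-injection f {x ∷ xs} (x∉xs ∷ uxs) inj into
  with ys′ , |ys|≡ , keep ← ∈⇒removal (into (here refl)) =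
  subst (suc (length xs) ≤_) (sym |ys|≡)
    (s≤s (length-≤-by-injection f uxs (λ p q → inj (there p) (there q)) λ y∈ →
      keep (into (there y∈)) λ fy≡fx → All.lookup x∉xs y∈ (sym (inj (there y∈) (here refl) fy≡fx))))

module _ {A : Set} where

  length-≤-of-⊆ : ∀ {xs ys : List A} → Unique xs → (∀ {x} → x ∈ xs → x ∈ ys) → length xs ≤ length ys
  length-≤-of-⊆ uxs = length-≤-by-injection id uxs (λ _ _ e → e)

  _!_ : List A → ℕ → Maybe A
  [] ! _ = nothing
  (x ∷ xs) ! zero = just x
  (x ∷ xs) ! suc p = xs ! p

  length>0⇒∃∈ : ∀ {xs : List A} → 0 < length xs → ∃ (_∈ xs)
  length>0⇒∃∈ {x ∷ _} _ = x , here refl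

  ∈⇒! : ∀ {v : A} {xs} → v ∈ xs → ∃ λ p → xs ! p ≡ just v
  ∈⇒! (here refl) = 0 , refl
  ∈⇒! (there v∈) with p , at ← ∈⇒! v∈ = suc p , at

  !-split₁ : ∀ (xs : List A) q {y} → xs ! q ≡ just y → ∃₂ λ mid D → xs ≡ mid ++ y ∷ D × length mid ≡ q
  !-split₁ (x ∷ xs) zero refl = [] , xs , refl , refl
  !-split₁ (x ∷ xs) (suc q) at with mid , D , xs≡ , |mid| ← !-split₁ xs q at =
    x ∷ mid , D , cong (x ∷_) xs≡ , cong suc |mid|

  !-split₂ : ∀ (xs : List A) p q {x y} → xs ! p ≡ just x → xs ! q ≡ just y → p < q →
             ∃ λ pre → ∃₂ λ mid D → xs ≡ pre ++ x ∷ mid ++ y ∷ D × q ≡ suc (p + length mid)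
  !-split₂ (u ∷ xs) zero (suc q) refl at-q _ with mid , D , xs≡ , |mid| ← !-split₁ xs q at-q =
    [] , mid , D , cong (u ∷_) xs≡ , cong suc (sym |mid|)
  !-split₂ (u ∷ xs) (suc p) (suc q) at-p at-q (s≤s p<q)
    with pre , mid , D , xs≡ , q≡ ← !-split₂ xs p q at-p at-q p<q =
    u ∷ pre , mid , D , cong (u ∷_) xs≡ , cong suc q≡

  !⇒∈-take : ∀ (xs : List A) {q w v} → xs ! q ≡ just v → q < w → v ∈ take w xs
  !⇒∈-take (x ∷ xs) {zero} {suc w} refl _ = here refl
  !⇒∈-take (x ∷ xs) {suc q} {suc w} at (s≤s q<w) = there (!⇒∈-take xs at q<w)

  ∈-window : ∀ (xs : List A) p {q w v} → xs ! q ≡ just v → p ≤ q → q < p + w → v ∈ take w (drop p xs)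
  ∈-window xs zero at _ q<w = !⇒∈-take xs at q<w
  ∈-window (x ∷ xs) (suc p) {suc q} at (s≤s p≤q) (s≤s q<) = ∈-window xs p at p≤q q<

  first-occurrence : ∀ {Pr : A → Set} → Decidable Pr → (xs : List A) →
    (∀ {v} → v ∈ xs → ¬ Pr v) ⊎
    (∃₂ λ p v → xs ! p ≡ just v × Pr v × (∀ q {w} → xs ! q ≡ just w → Pr w → p ≤ q))
  first-occurrence Pr? [] = inj₁ λ ()
  first-occurrence Pr? (x ∷ xs) with Pr? x
  ... | yes px = inj₂ (0 , x , refl , px , λ _ _ _ → z≤n)
  ... | no ¬px with first-occurrence Pr? xs
  ...   | inj₁ none = inj₁ λ where
          (here refl) → ¬px
          (there v∈) → none v∈
  ...   | inj₂ (p , v , at , pv , least) = inj₂ (suc p , v , at , pv , λ where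
          zero refl pw → ⊥-elim (¬px pw)
          (suc q) at-q pw → s≤s (least q at-q pw))

  last-++-∷ : ∀ (xs : List A) {y ys} → last (xs ++ y ∷ ys) ≡ last (y ∷ ys)
  last-++-∷ [] = refl
  last-++-∷ (x ∷ []) = refl
  last-++-∷ (x ∷ x′ ∷ xs) = last-++-∷ (x′ ∷ xs)

  last-∷ʳ : ∀ (xs : List A) {y} → last (xs ∷ʳ y) ≡ just y
  last-∷ʳ xs = last-++-∷ xs

  head-++-∷ : ∀ (xs : List A) {x ys ys′} → head (xs ++ x ∷ ys) ≡ head (xs ++ x ∷ ys′)
  head-++-∷ [] = refl
  head-++-∷ (_ ∷ _) = refl

  last-reverse : ∀ (xs : List A) → last (reverse xs) ≡ head xs
  last-reverse [] = refl
  last-reverse (x ∷ xs) = trans (cong last (unfold-reverse x xs)) (last-∷ʳ (reverse xs))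

  head-reverse : ∀ (xs : List A) → head (reverse xs) ≡ last xs
  head-reverse xs = trans (sym (last-reverse (reverse xs))) (cong last (reverse-involutive xs))

  module _ {R : A → A → Set} where

    Linked-++⁻ˡ : ∀ xs {ys} → Linked R (xs ++ ys) → Linked R xs
    Linked-++⁻ˡ [] _ = []
    Linked-++⁻ˡ (x ∷ []) _ = [-]
    Linked-++⁻ˡ (x ∷ x′ ∷ xs) (r ∷ l) = r ∷ Linked-++⁻ˡ (x′ ∷ xs) l

    Linked-++⁻ʳ : ∀ xs {ys} → Linked R (xs ++ ys) → Linked R ys
    Linked-++⁻ʳ [] l = l
    Linked-++⁻ʳ (x ∷ xs) l = Linked-++⁻ʳ xs (Linked.tail l)

    Linked-join : ∀ xs {y ys} → Linked R (xs ∷ʳ y) → Linked R (y ∷ ys) → Linked R (xs ++ y ∷ ys)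
    Linked-join xs {y} {ys} l l′ = subst (Linked R) (++-assoc xs [ y ] ys)
      (Linked.++⁺ l (subst (λ m → Connected R m (head ys)) (sym (last-∷ʳ xs)) (Linked.head′ l′))
                    (Linked.tail l′))

    Linked-∷ʳ : ∀ xs {y z} → Linked R (xs ∷ʳ y) → R y z → Linked R (xs ∷ʳ y ∷ʳ z)
    Linked-∷ʳ xs {y} {z} l r =
      Linked.++⁺ l (subst (λ m → Connected R m (just z)) (sym (last-∷ʳ xs)) (just r)) [-]

    Linked-reverse : ∀ {xs} → Linked R xs → Linked (flip R) (reverse xs)
    Linked-reverse [] = []
    Linked-reverse [-] = [-]
    Linked-reverse {x ∷ y ∷ ys} (r ∷ l) = subst (Linked (flip R)) (sym (unfold-reverse x (y ∷ ys)))
      (Linked.++⁺ (Linked-reverse l)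
        (subst (λ m → Connected (flip R) m (just x)) (sym (last-reverse (y ∷ ys))) (just r)) [-])

  Unique-reverse : ∀ {xs : List A} → Unique xs → Unique (reverse xs)
  Unique-reverse {xs} = Permutationₛ.Unique-resp-↭ (setoid A) (↭⇒↭ₛ (↭-sym (↭-reverse xs)))

  Unique-++⁻ʳ : ∀ (xs : List A) {ys} → Unique (xs ++ ys) → Unique ys
  Unique-++⁻ʳ [] u = u
  Unique-++⁻ʳ (x ∷ xs) (_ ∷ u) = Unique-++⁻ʳ xs u

  Unique-reroute : ∀ (pre : List A) {mid L ys} → Unique (pre ++ mid ++ ys) → Unique L →
                   (∀ {z} → z ∈ L → z ∉ pre ++ mid ++ ys) → Unique (pre ++ L ++ ys)
  Unique-reroute [] {mid} u uL fresh =
    Unique.++⁺ uL (Unique-++⁻ʳ mid u) λ (z∈L , z∈ys) → fresh z∈L (∈-++⁺ʳ mid z∈ys)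
  Unique-reroute (x ∷ pre) {mid} {L} {ys} (x∉ ∷ u) uL fresh =
    All.tabulate x≢ ∷ Unique-reroute pre u uL (λ z∈L z∈ → fresh z∈L (there z∈))
    where
    x≢ : ∀ {z} → z ∈ pre ++ L ++ ys → x ≢ z
    x≢ z∈ with ∈-++⁻ pre z∈
    ... | inj₁ z∈pre = All.lookup x∉ (∈-++⁺ˡ z∈pre)
    ... | inj₂ z∈ with ∈-++⁻ L z∈
    ...   | inj₁ z∈L = λ x≡z → fresh z∈L (here (sym x≡z))
    ...   | inj₂ z∈ys = All.lookup x∉ (∈-++⁺ʳ pre (∈-++⁺ʳ mid z∈ys))

  ∈-reroute : ∀ (pre : List A) {x L y D} mid {v} →
              v ∈ pre ++ x ∷ L ++ y ∷ D → v ∈ L ⊎ v ∈ pre ++ x ∷ mid ++ y ∷ D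
  ∈-reroute pre {L = L} mid v∈ with ∈-++⁻ pre v∈
  ... | inj₁ v∈pre = inj₂ (∈-++⁺ˡ v∈pre)
  ... | inj₂ (here v≡x) = inj₂ (∈-++⁺ʳ pre (here v≡x))
  ... | inj₂ (there v∈) with ∈-++⁻ L v∈
  ...   | inj₁ v∈L = inj₁ v∈L
  ...   | inj₂ v∈ = inj₂ (∈-++⁺ʳ pre (there (∈-++⁺ʳ mid v∈)))

  length-reroute-< : ∀ (pre : List A) {x L mid y D} → length L < length mid →
                     length (pre ++ x ∷ L ++ y ∷ D) < length (pre ++ x ∷ mid ++ y ∷ D)
  length-reroute-< pre {x} {L} {mid} {y} {D} shorter
    rewrite length-++ pre {x ∷ L ++ y ∷ D} | length-++ pre {x ∷ mid ++ y ∷ D}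
          | length-++ L {y ∷ D} | length-++ mid {y ∷ D} =
    +-monoʳ-< (length pre) (s≤s (+-monoˡ-< (suc (length D)) shorter))

  last-reroute : ∀ (pre : List A) {x L mid y D} →
                 last (pre ++ x ∷ L ++ y ∷ D) ≡ last (pre ++ x ∷ mid ++ y ∷ D)
  last-reroute pre {x} {L} {mid} {y} {D} = begin
    last (pre ++ x ∷ L ++ y ∷ D)       ≡⟨ cong last (++-assoc pre (x ∷ L) (y ∷ D)) ⟨
    last ((pre ++ x ∷ L) ++ y ∷ D)     ≡⟨ last-++-∷ (pre ++ x ∷ L) ⟩
    last (y ∷ D)                       ≡⟨ last-++-∷ (pre ++ x ∷ mid) ⟨
    last ((pre ++ x ∷ mid) ++ y ∷ D)   ≡⟨ cong last (++-assoc pre (x ∷ mid) (y ∷ D)) ⟩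
    last (pre ++ x ∷ mid ++ y ∷ D)     ∎
    where open ≡-Reasoning

module _ {I : Set} (f g : I → ℕ) where

  sum-map-≤ : ∀ xs → (∀ l → f l ≤ g l) → sum (map f xs) ≤ sum (map g xs)
  sum-map-≤ [] _ = z≤n
  sum-map-≤ (x ∷ xs) f≤g = +-mono-≤ (f≤g x) (sum-map-≤ xs f≤g)

  sum-map-< : ∀ xs {i} → i ∈ xs → (∀ l → f l ≤ g l) → f i < g i → sum (map f xs) < sum (map g xs)
  sum-map-< (x ∷ xs) (here refl) f≤g fi<gi = +-mono-<-≤ fi<gi (sum-map-≤ xs f≤g)
  sum-map-< (x ∷ xs) (there i∈) f≤g fi<gi = +-mono-≤-< (f≤g x) (sum-map-< xs i∈ f≤g fi<gi)

length-concatMap-≤ : ∀ {I B : Set} (f : I → List B) w → (∀ x → length (f x) ≤ w) →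
                     ∀ xs → length (concatMap f xs) ≤ length xs * w
length-concatMap-≤ f w _ [] = z≤n
length-concatMap-≤ f w |f|≤w (x ∷ xs) =
  subst (_≤ w + length xs * w) (sym (length-++ (f x))) (+-mono-≤ (|f|≤w x) (length-concatMap-≤ f w |f|≤w xs))

updateAt-cases : ∀ {A : Set} {k} (P : Fin k → A) i {Q} l →
                 (l ≡ i × updateAt P i (const Q) l ≡ Q) ⊎ updateAt P i (const Q) l ≡ P l
updateAt-cases P i l with l ≟ i
... | yes refl = inj₁ (refl , updateAt-updates i P)
... | no l≢i = inj₂ (updateAt-minimal l i P l≢i)

module _ {n : ℕ} {E : Fin n → Fin n → Set} where

  IsPath-reroute : ∀ {s t} pre {x mid y D L} → IsPath E s t (pre ++ x ∷ mid ++ y ∷ D) → Unique L →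
                   (∀ {z} → z ∈ L → z ∉ pre ++ x ∷ mid ++ y ∷ D) → Linked E (x ∷ L ++ [ y ]) →
                   IsPath E s t (pre ++ x ∷ L ++ y ∷ D)
  IsPath-reroute pre {x} {mid} {y} {D} {L} (uP , lP , hP , tP) uL fresh lk =
    subst Unique (++-assoc pre [ x ] (L ++ y ∷ D))
      (Unique-reroute (pre ∷ʳ x) (subst Unique (sym (++-assoc pre [ x ] (mid ++ y ∷ D))) uP) uL
        λ z∈L z∈ → fresh z∈L (subst (_ ∈_) (++-assoc pre [ x ] (mid ++ y ∷ D)) z∈)) ,
    Linked-join pre before (Linked-join (x ∷ L) lk after) ,
    trans (head-++-∷ pre) hP ,
    trans (last-reroute pre) tP
    where
    before : Linked E (pre ∷ʳ x)
    before = Linked-++⁻ˡ (pre ∷ʳ x) (subst (Linked E) (sym (++-assoc pre [ x ] (mid ++ y ∷ D))) lP)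
    after : Linked E (y ∷ D)
    after = Linked-++⁻ʳ (pre ++ x ∷ mid) (subst (Linked E) (sym (++-assoc pre (x ∷ mid) (y ∷ D))) lP)

  IsPath-reverse : ∀ {s t P} → IsPath E s t P → IsPath (flip E) t s (reverse P)
  IsPath-reverse {P = P} (uP , lP , hP , tP) =
    Unique-reverse uP , Linked-reverse lP , trans (head-reverse P) tP , trans (last-reverse P) hP

module _ {n k : ℕ} where
  open DecMembership (_≟_ {n}) using (_∈?_)

  ∈-ListOf⁺ : ∀ (P : Fin k → List (Fin n)) {v l} → v ∈ P l → l ∈ ListOf P v
  ∈-ListOf⁺ P {v} {l} v∈ = ∈-filter⁺ (λ i → v ∈? P i) (∈-allFin l) v∈

  ∈-ListOf⁻ : ∀ (P : Fin k → List (Fin n)) {v l} → l ∈ ListOf P v → v ∈ P l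
  ∈-ListOf⁻ P {v} l∈ = proj₂ (∈-filter⁻ (λ i → v ∈? P i) {xs = allFin k} l∈)

  ListOf-unique : ∀ (P : Fin k → List (Fin n)) v → Unique (ListOf P v)
  ListOf-unique P v = Unique.filter⁺ (λ i → v ∈? P i) (Unique.allFin⁺ k)

  ListOf-mono : ∀ (P Q : Fin k → List (Fin n)) v → (∀ {l} → v ∈ Q l → v ∈ P l) →
                length (ListOf Q v) ≤ length (ListOf P v)
  ListOf-mono P Q v Q⊆P = length-≤-of-⊆ (ListOf-unique Q v) (λ l∈ → ∈-ListOf⁺ P (Q⊆P (∈-ListOf⁻ Q l∈)))

  ListOf-disjoint : ∀ (P : Fin k → List (Fin n)) {u v} → (∀ {l} → u ∈ P l → v ∉ P l) →
                    length (ListOf P u) + length (ListOf P v) ≤ k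
  ListOf-disjoint P {u} {v} apart = begin
    length (ListOf P u) + length (ListOf P v) ≡⟨ length-++ (ListOf P u) ⟨
    length (ListOf P u ++ ListOf P v)         ≤⟨ length-≤-of-⊆ unique (λ {l} _ → ∈-allFin l) ⟩
    length (allFin k)                         ≡⟨ length-tabulate id ⟩
    k                                         ∎
    where
    open ≤-Reasoning
    unique : Unique (ListOf P u ++ ListOf P v)
    unique = Unique.++⁺ (ListOf-unique P u) (ListOf-unique P v)
      λ (l∈u , l∈v) → apart (∈-ListOf⁻ P l∈u) (∈-ListOf⁻ P l∈v)

  IsSolution-update : ∀ {E : Fin n → Fin n → Set} {s t c P} i {Q} → IsSolution E s t c P →
                      IsPath E (s i) (t i) Q → (∀ {v} → v ∈ Q → v ∉ P i → suc (length (ListOf P v)) ≤ c) →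
                      IsSolution E s t c (updateAt P i (const Q))
  IsSolution-update {E} {s} {t} {c} {P} i {Q} (paths , loads) Q-path spare = paths′ , loads′
    where
    P′ : Fin k → List (Fin n)
    P′ = updateAt P i (const Q)
    paths′ : ∀ l → IsPath E (s l) (t l) (P′ l)
    paths′ l with updateAt-cases P i l
    ... | inj₁ (refl , P′l≡) = subst (IsPath E (s i) (t i)) (sym P′l≡) Q-path
    ... | inj₂ P′l≡ = subst (IsPath E (s l) (t l)) (sym P′l≡) (paths l)
    on-P′ : ∀ {v l} → v ∈ P′ l → (l ≡ i × v ∈ Q) ⊎ v ∈ P l
    on-P′ {v} {l} v∈ with updateAt-cases P i l
    ... | inj₁ (l≡i , P′l≡) = inj₁ (l≡i , subst (v ∈_) P′l≡ v∈)
    ... | inj₂ P′l≡ = inj₂ (subst (v ∈_) P′l≡ v∈)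
    old-on : ∀ {v} → (v ∈ Q → v ∈ P i) → ∀ {l} → v ∈ P′ l → v ∈ P l
    old-on Q⊆P {l} v∈ with on-P′ {l = l} v∈
    ... | inj₁ (refl , v∈Q) = Q⊆P v∈Q
    ... | inj₂ v∈P = v∈P
    new-on : ∀ {v l} → l ∈ ListOf P′ v → l ∈ i ∷ ListOf P v
    new-on {v} l∈ with on-P′ (∈-ListOf⁻ P′ l∈)
    ... | inj₁ (l≡i , _) = here l≡i
    ... | inj₂ v∈P = there (∈-ListOf⁺ P v∈P)
    loads′ : ∀ v → length (ListOf P′ v) ≤ c
    loads′ v with v ∈? P i | v ∈? Q
    ... | yes v∈P | _ = ≤-trans (ListOf-mono P P′ v (old-on λ _ → v∈P)) (loads v)
    ... | no v∉P | yes v∈Q = ≤-trans (length-≤-of-⊆ (ListOf-unique P′ v) new-on) (spare v∈Q v∉P)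
    ... | no _ | no v∉Q = ≤-trans (ListOf-mono P P′ v (old-on λ v∈Q → ⊥-elim (v∉Q v∈Q))) (loads v)

  totalSize-update-< : ∀ (P : Fin k → List (Fin n)) i {Q} → length Q < length (P i) →
                       totalSize (updateAt P i (const Q)) < totalSize P
  totalSize-update-< P i {Q} shorter =
    sum-map-< (λ l → length (P′ l)) (λ l → length (P l)) (allFin k) (∈-allFin i) shrinks
      (subst (λ R → length R < length (P i)) (sym (updateAt-updates i P)) shorter)
    where
    P′ : Fin k → List (Fin n)
    P′ = updateAt P i (const Q)
    shrinks : ∀ l → length (P′ l) ≤ length (P l)
    shrinks l with updateAt-cases P i l
    ... | inj₁ (refl , P′l≡) = subst (λ R → length R ≤ length (P i)) (sym P′l≡) (<⇒≤ shorter)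
    ... | inj₂ P′l≡ = ≤-reflexive (cong length P′l≡)

  IsSolution-reverse : ∀ {E : Fin n → Fin n → Set} {s t c P} → IsSolution E s t c P →
                       IsSolution (flip E) t s c (λ l → reverse (P l))
  IsSolution-reverse {P = P} (paths , loads) =
    (λ l → IsPath-reverse (paths l)) ,
    (λ v → ≤-trans (ListOf-mono P (λ l → reverse (P l)) v reverse⁻) (loads v))

  totalSize-reverse : ∀ (P : Fin k → List (Fin n)) → totalSize (λ l → reverse (P l)) ≡ totalSize P
  totalSize-reverse P = cong sum (map-cong (λ l → length-reverse (P l)) (allFin k))

countIn-reverse : ∀ {n m} (f : Fin m → Fin n) xs → countIn f (reverse xs) ≡ countIn f xs
countIn-reverse f xs = ↭-length (filter-↭ (λ v → any? (λ j → f j ≟ v)) (↭-reverse xs))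

record Setting : Set₁ where
  field
    n k c m : ℕ
    E : Fin n → Fin n → Set
    s t : Fin k → Fin n
    k<2c : k < 2 * c
    T : Triple E m
    P : Fin k → List (Fin n)
    solution : IsSolution E s t c P
    minimal : ∀ Q → IsSolution E s t c Q → totalSize P ≤ totalSize Q
    j₀ : Fin m
    room-at-b : length (ListOf P (Triple.b T j₀)) ≤ c ∸ 1

module Minimality (S : Setting) where
  open Setting S
  open Triple T renaming (a to A; b to B; c to C)
  open DecMembership (_≟_ {n}) using (_∈?_)

  load : Fin n → ℕ
  load v = length (ListOf P v)

  Spare Saturated : Fin n → Set
  Spare v = suc (load v) ≤ c
  Saturated v = c ≤ load v

  spare-or-saturated : ∀ v → Spare v ⊎ Saturated v
  spare-or-saturated v with suc (load v) ≤? c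
  ... | yes spare = inj₁ spare
  ... | no ¬spare = inj₂ (≤-pred (≰⇒> ¬spare))

  1≤c : 1 ≤ c
  1≤c with c | k<2c
  ... | suc _ | _ = s≤s z≤n

  b : Fin n
  b = B j₀

  b-spare : Spare b
  b-spare = ≤-trans (s≤s room-at-b) (≤-reflexive (trans (+-comm 1 (c ∸ 1)) (m∸n+n≡m 1≤c)))

  no-shortcut : ∀ i {pre x mid y D L} → P i ≡ pre ++ x ∷ mid ++ y ∷ D → length L < length mid →
                Unique L → Linked E (x ∷ L ++ [ y ]) → (∀ {z} → z ∈ L → z ∉ P i × Spare z) → ⊥
  no-shortcut i {pre} {x} {mid} {y} {D} {L} P≡ shorter uL lk fresh =
    <⇒≱ (totalSize-update-< P i Q-shorter) (minimal _ (IsSolution-update i solution Q-path spare-on-Q))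
    where
    Q : List (Fin n)
    Q = pre ++ x ∷ L ++ y ∷ D
    Q-path : IsPath E (s i) (t i) Q
    Q-path = IsPath-reroute pre (subst (IsPath E (s i) (t i)) P≡ (proj₁ solution i)) uL
      (λ z∈L z∈ → proj₁ (fresh z∈L) (subst (_ ∈_) (sym P≡) z∈)) lk
    spare-on-Q : ∀ {v} → v ∈ Q → v ∉ P i → Spare v
    spare-on-Q v∈Q v∉P with ∈-reroute pre mid v∈Q
    ... | inj₁ v∈L = proj₂ (fresh v∈L)
    ... | inj₂ v∈P = ⊥-elim (v∉P (subst (_ ∈_) (sym P≡) v∈P))
    Q-shorter : length Q < length (P i)
    Q-shorter = subst (λ R → length Q < length R) (sym P≡) (length-reroute-< pre shorter)

  no-shortcut-at : ∀ i {p q x y L} → P i ! p ≡ just x → P i ! q ≡ just y → length L + suc p < q →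
                   Unique L → Linked E (x ∷ L ++ [ y ]) → (∀ {z} → z ∈ L → z ∉ P i × Spare z) → ⊥
  no-shortcut-at i {p} {q} {L = L} at-p at-q far
    with pre , mid , D , P≡ , refl ← !-split₂ (P i) p q at-p at-q (m+n≤o⇒n≤o (length L) (<⇒≤ far)) =
    no-shortcut i P≡ (cancel-p (length L) (length mid) far)
    where
    cancel-p : ∀ l m → l + suc p < suc (p + m) → l < m
    cancel-p l m lt = +-cancelʳ-< p l m (subst₂ _≤_ (+-suc l p) (+-comm p m) (≤-pred lt))

  no-chord : ∀ i {p q x y} → P i ! p ≡ just x → P i ! q ≡ just y → suc p < q → ¬ E x y
  no-chord i at-p at-q far xy = no-shortcut-at i {L = []} at-p at-q far [] (xy ∷ [-]) (λ ())

  MateBlocked : Fin k → Fin m → Set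
  MateBlocked i j = C j ∉ P i × Saturated (C j)

  -- c_j on P_i would give the chord c_j → a_j or the shortcut x ⇝ c_j through L, and a spare c_j
  -- the shortcut x ⇝ c_j → a_j.
  mate-blocked-after : ∀ i {p x L} → P i ! p ≡ just x → Unique L → (∀ {z} → z ∈ L → z ∉ P i × Spare z) →
                       (∀ j → C j ∉ L × Linked E (x ∷ L ++ [ C j ])) →
                       ∀ j {q} → P i ! q ≡ just (A j) → length L + suc (suc p) < q → MateBlocked i j
  mate-blocked-after i {p} {x} {L} at-p uL fresh route j {q} at-q far = C∉P , C-saturated
    where
    C∉P : C j ∉ P i
    C∉P C∈P with u , at-u ← ∈⇒! C∈P with suc u <? q
    ... | yes u+1<q = no-chord i at-u at-q u+1<q (ca-arc j)
    ... | no u+1≮q = no-shortcut-at i at-p at-u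
      (≤-pred (≤-trans (subst (_< q) (+-suc (length L) (suc p)) far) (≮⇒≥ u+1≮q)))
      uL (proj₂ (route j)) fresh
    C-saturated : Saturated (C j)
    C-saturated with spare-or-saturated (C j)
    ... | inj₂ saturated = saturated
    ... | inj₁ spare = ⊥-elim (no-shortcut-at i {L = L ∷ʳ C j} at-p at-q
      (subst (_< q) (sym (trans (cong (_+ suc p) (length-++ L)) (+-assoc (length L) 1 (suc p)))) far)
      (Unique.++⁺ uL (All.[] ∷ []) λ { (z∈L , here refl) → proj₁ (route j) z∈L })
      (Linked-∷ʳ (x ∷ L) (proj₂ (route j)) (ca-arc j))
      fresh′)
      where
      fresh′ : ∀ {z} → z ∈ L ∷ʳ C j → z ∉ P i × Spare z
      fresh′ z∈ with ∈-++⁻ L z∈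
      ... | inj₁ z∈L = fresh z∈L
      ... | inj₂ (here refl) = C∉P , spare

  isA? : Decidable (InImage A)
  isA? v = any? (λ j → A j ≟ v)

  window : Fin k → ℕ → List (Fin n)
  window i p = take 4 (drop p (P i))

  |window| : ∀ i p → length (window i p) ≤ 4
  |window| i p = subst (_≤ 4) (sym (length-take 4 (drop p (P i)))) (m⊓n≤m 4 _)

  around-b : ∀ i {r} → P i ! r ≡ just b → ∀ j → A j ∈ P i → A j ∈ window i (r ∸ 1) ⊎ MateBlocked i j
  around-b i {r} at-r j A∈P with q , at-q ← ∈⇒! A∈P with suc q <? r
  ... | yes q+1<r = ⊥-elim (no-chord i at-q at-r q+1<r (ab-arc j j₀))
  ... | no q+1≮r with q ≤? 2 + r
  ...   | yes near = inj₁ (∈-window (P i) (r ∸ 1) at-q (r∸1≤ r (≮⇒≥ q+1≮r)) (<r∸1+4 r near))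
    where
    r∸1≤ : ∀ r {q} → r ≤ suc q → r ∸ 1 ≤ q
    r∸1≤ zero _ = z≤n
    r∸1≤ (suc r) (s≤s r≤q) = r≤q
    <r∸1+4 : ∀ r {q} → q ≤ 2 + r → q < r ∸ 1 + 4
    <r∸1+4 zero q≤2 = s≤s (m≤n⇒m≤1+n q≤2)
    <r∸1+4 (suc r) {q} q≤3+r = subst (suc q ≤_) (+-comm 4 r) (s≤s q≤3+r)
  ...   | no far =
    inj₂ (mate-blocked-after i at-r [] (λ ()) (λ j → (λ ()) , bc-arc j₀ j ∷ [-]) j at-q (≰⇒> far))

  after-first-A : ∀ i → b ∉ P i → ∀ {p x} → P i ! p ≡ just x → InImage A x →
                  (∀ q {w} → P i ! q ≡ just w → InImage A w → p ≤ q) →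
                  ∀ j → A j ∈ P i → A j ∈ window i p ⊎ MateBlocked i j
  after-first-A i b∉P {p} {x} at-p (j₁ , A≡x) least j A∈P with q , at-q ← ∈⇒! A∈P with q <? p + 4
  ... | yes near = inj₁ (∈-window (P i) p at-q (least q at-q (j , refl)) near)
  ... | no far = inj₂ (mate-blocked-after i at-p (All.[] ∷ []) (λ { (here refl) → b∉P , b-spare }) via-b j at-q
                        (subst (_≤ q) (+-comm p 4) (≮⇒≥ far)))
    where
    via-b : ∀ j → C j ∉ [ b ] × Linked E (x ∷ b ∷ [ C j ])
    via-b j = (λ { (here C≡b) → bc-disj j₀ j (sym C≡b) }) ,
              subst (λ v → E v b) A≡x (ab-arc j₁ j₀) ∷ bc-arc j₀ j ∷ [-]

  A-window : ∀ i → ∃ λ W → length W ≤ 4 × (∀ j → A j ∈ P i → A j ∈ W ⊎ MateBlocked i j)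
  A-window i with b ∈? P i
  ... | yes b∈P = let r , at-r = ∈⇒! b∈P in window i (r ∸ 1) , |window| i (r ∸ 1) , around-b i at-r
  ... | no b∉P with first-occurrence isA? (P i)
  ...   | inj₁ no-A = [] , z≤n , λ j A∈P → ⊥-elim (no-A A∈P (j , refl))
  ...   | inj₂ (p , x , at-p , A-x , least) = window i p , |window| i p , after-first-A i b∉P at-p A-x least

reverse-setting : Setting → Setting
reverse-setting S = record
  { n = n ; k = k ; c = c ; m = m ; E = flip E ; s = t ; t = s ; k<2c = k<2c
  ; T = record
    { a = C ; b = B ; c = A ; a-inj = c-inj ; b-inj = b-inj ; c-inj = a-inj
    ; ab-disj = λ i j → bc-disj j i ∘ sym ; bc-disj = λ i j → ab-disj j i ∘ sym
    ; ac-disj = λ i j → ac-disj j i ∘ sym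
    ; ab-arc = λ i j → bc-arc j i ; bc-arc = λ i j → ab-arc j i ; ca-arc = ca-arc }
  ; P = λ l → reverse (P l)
  ; solution = IsSolution-reverse solution
  ; minimal = λ Q Q-solution → subst₂ _≤_ (sym (totalSize-reverse P)) (totalSize-reverse Q)
      (minimal (λ l → reverse (Q l)) (IsSolution-reverse Q-solution))
  ; j₀ = j₀
  ; room-at-b = ≤-trans (ListOf-mono P (λ l → reverse (P l)) (B j₀) reverse⁻) room-at-b
  }
  where
  open Setting S
  open Triple T renaming (a to A; b to B; c to C)

module Bound (S : Setting) where
  open Setting S
  open Triple T renaming (a to A; b to B; c to C)
  open Minimality S
  private module Reversed = Minimality (reverse-setting S)
  open DecMembership (_≟_ {n}) using (_∈?_)

  reversed-mate-blocked : ∀ {l j} → Reversed.MateBlocked l j → A j ∉ P l × Saturated (A j)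
  reversed-mate-blocked {l} {j} (A∉ , saturated) =
    A∉ ∘ reverse⁺ , ≤-trans saturated (ListOf-mono P (λ l → reverse (P l)) (A j) reverse⁻)

  C-window : ∀ l → ∃ λ W → length W ≤ 4 × (∀ j → C j ∈ P l → C j ∈ W ⊎ (A j ∉ P l × Saturated (A j)))
  C-window l with W , |W|≤4 , sorted ← Reversed.A-window l =
    W , |W|≤4 , λ j C∈P → Sum.map₂ reversed-mate-blocked (sorted j (reverse⁺ C∈P))

  C-windows : List (Fin n)
  C-windows = concatMap (λ l → proj₁ (C-window l)) (allFin k)

  ∈-C-windows : ∀ {l v} → v ∈ proj₁ (C-window l) → v ∈ C-windows
  ∈-C-windows {l} v∈ = ∈-concatMap⁺ (λ l → proj₁ (C-window l)) (Any.map (λ { refl → v∈ }) (∈-allFin l))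

  |C-windows| : length C-windows ≤ k * 4
  |C-windows| = subst (λ x → length C-windows ≤ x * 4) (length-tabulate {n = k} id)
    (length-concatMap-≤ (λ l → proj₁ (C-window l)) 4 (λ l → proj₁ (proj₂ (C-window l))) (allFin k))

  saturated⇒∈-C-windows : ∀ j → Saturated (C j) → C j ∈ C-windows
  saturated⇒∈-C-windows j C-saturated with C j ∈? C-windows
  ... | yes C∈ = C∈
  ... | no C∉ = ⊥-elim (<⇒≱ k<2c (begin
    2 * c                   ≡⟨ cong (c +_) (+-identityʳ c) ⟩
    c + c                   ≤⟨ +-mono-≤ C-saturated A-saturated ⟩
    load (C j) + load (A j) ≤⟨ ListOf-disjoint P (λ C∈P → proj₁ (A-off C∈P)) ⟩
    k                       ∎))
    where
    open ≤-Reasoning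
    A-off : ∀ {l} → C j ∈ P l → A j ∉ P l × Saturated (A j)
    A-off {l} C∈P with proj₂ (proj₂ (C-window l)) j C∈P
    ... | inj₁ C∈W = ⊥-elim (C∉ (∈-C-windows C∈W))
    ... | inj₂ off = off
    A-saturated : Saturated (A j)
    A-saturated = proj₂ (A-off (∈-ListOf⁻ P (proj₂ (length>0⇒∃∈ (≤-trans 1≤c C-saturated)))))

  mate : Fin n → Fin n
  mate v with isA? v
  ... | yes (j , _) = C j
  ... | no _ = v

  mate-A : ∀ j → mate (A j) ≡ C j
  mate-A j with isA? (A j)
  ... | yes (j′ , A≡) = cong C (a-inj j′ j A≡)
  ... | no ¬A = ⊥-elim (¬A (j , refl))

  A-count : ∀ i → countIn A (P i) ≤ 8 * c + 4
  A-count i with W , |W|≤4 , sorted ← A-window i = begin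
    countIn A (P i)                        ≤⟨ length-≤-by-injection mate unique mate-inj into ⟩
    length (map mate W ++ C-windows)       ≡⟨ length-++ (map mate W) ⟩
    length (map mate W) + length C-windows ≡⟨ cong (_+ length C-windows) (length-map mate W) ⟩
    length W + length C-windows            ≤⟨ +-mono-≤ |W|≤4 (≤-trans |C-windows| (*-monoˡ-≤ 4 (<⇒≤ k<2c))) ⟩
    4 + 2 * c * 4                          ≡⟨ +-comm 4 _ ⟩
    2 * c * 4 + 4                          ≡⟨ cong (_+ 4) (trans (*-comm (2 * c) 4) (sym (*-assoc 4 2 c))) ⟩
    8 * c + 4                              ∎
    where
    open ≤-Reasoning
    unique : Unique (filter isA? (P i))
    unique = Unique.filter⁺ isA? (proj₁ (proj₁ solution i))
    on-path : ∀ {v} → v ∈ filter isA? (P i) → ∃ λ j → A j ≡ v × A j ∈ P i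
    on-path v∈ with v∈P , (j , A≡v) ← ∈-filter⁻ isA? {xs = P i} v∈ =
      j , A≡v , subst (_∈ P i) (sym A≡v) v∈P
    mate-inj : ∀ {x y} → x ∈ filter isA? (P i) → y ∈ filter isA? (P i) → mate x ≡ mate y → x ≡ y
    mate-inj x∈ y∈ mate≡ with on-path x∈ | on-path y∈
    ... | jx , refl , _ | jy , refl , _ =
      cong A (c-inj jx jy (trans (sym (mate-A jx)) (trans mate≡ (mate-A jy))))
    into : ∀ {x} → x ∈ filter isA? (P i) → mate x ∈ map mate W ++ C-windows
    into x∈ with on-path x∈
    ... | j , refl , A∈P with sorted j A∈P
    ...   | inj₁ A∈W = ∈-++⁺ˡ (∈-map⁺ mate A∈W)
    ...   | inj₂ (_ , saturated) =
      ∈-++⁺ʳ (map mate W) (subst (_∈ C-windows) (sym (mate-A j)) (saturated⇒∈-C-windows j saturated))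

lemma26 : (n k c m : ℕ) (E : Fin n → Fin n → Set) → Semicomplete E
    → (s t : Fin k → Fin n) → k < 2 * c
    → (T : Triple E m)
    → (∀ i → ¬ Triple.InABC T (s i)) → (∀ i → ¬ Triple.InABC T (t i))
    → (∀ i j → ¬ E (Triple.c T i) (Triple.b T j))
    → (∀ i j → ¬ E (Triple.b T i) (Triple.a T j))
    → (P : Fin k → List (Fin n)) → IsSolution E s t c P
    → (∀ Q → IsSolution E s t c Q → totalSize P ≤ totalSize Q)
    → (∃ λ j → length (ListOf P (Triple.b T j)) ≤ c ∸ 1)
    → ∀ i → countIn (Triple.a T) (P i) ≤ 8 * c + 4
          × countIn (Triple.c T) (P i) ≤ 8 * c + 4
lemma26 n k c m E _ s t k<2c T _ _ _ _ P solution minimal (j₀ , room-at-b) i =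
  Bound.A-count S i ,
  subst (_≤ 8 * c + 4) (countIn-reverse (Triple.c T) (P i)) (Bound.A-count (reverse-setting S) i)
  where
  S : Setting
  S = record { n = n ; k = k ; c = c ; m = m ; E = E ; s = s ; t = t ; k<2c = k<2c ; T = T ; P = P
             ; solution = solution ; minimal = minimal ; j₀ = j₀ ; room-at-b = room-at-b }
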